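{- Let $M$ and $K$ be finite disjoint sets with $|M|=m$, and let $P$ be a poset on $K$. Then $$e(m,P)=|\mathcal{E}(M,P)|=|\mathcal{F}(M,P)|=|\mathcal{G}(M,P)|=|\mathcal{H}(M,P)|=|\mathcal{I}(M,P)|,$$ where $\mathcal{E}(M,P)$ is the set of partial orders $Q$ on $M\cup K$ whose set of minimal elements is exactly $M$ and which induce $P$ on $K$; $\mathcal{F}(M,P)=\{f:K\to\mathcal{P}_0(M)\mid x\le_P y\Rightarrow f(x)\subseteq f(y)\}$; $\mathcal{G}(M,P)=\{g:M\to\mathcal{U}(P)\mid \bigcup g[M]=K\}$; $\mathcal{H}(M,P)=\{h:\mathcal{D}(P)\to\mathcal{P}(M)\mid h \text{ preserves unions, and } h(D)=\emptyset\Rightarrow D=\emptyset\}$; $\mathcal{I}(M,P)=\{R\subseteq M\times K\mid R(\le_P)\subseteq R,\ MR=K\}$. Moreover, $e(m,P)$ is also the number of $T_0$ topologies on $M\cup K$ whose subspace topology on $K$ is $\mathcal{D}(P)$ and whose isolated points are exactly the points of $M$.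
   Context: $e(m,P)$ is defined as $|\mathcal{E}(M,P)|$ (it depends only on $m$). $\mathcal{P}(M)$ is the power set of $M$ and $\mathcal{P}_0(M)$ the set of nonempty subsets of $M$. $\mathcal{D}(P)$ and $\mathcal{U}(P)$ are the sets of downsets and upsets of $P$; $\mathcal{D}(P)$ is regarded as a topology on $K$. For $R\subseteq M\times K$, $R(\le_P)=\{(a,y)\mid \exists x: (a,x)\in R, x\le_P y\}$ and $MR=\{y\mid \exists a\in M:(a,y)\in R\}$. -}

module Defs where

open import Data.Nat using (ℕ; _+_)
open import Data.Fin using (Fin; _↑ˡ_; _↑ʳ_)
open import Data.Bool using (Bool; T)
open import Data.Empty using () renaming (⊥ to False)
open import Data.Product using (Σ; ∃; ∃-syntax; _×_; _,_; proj₁)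
open import Data.Sum using (_⊎_)
open import Data.List using (List; map; allFin)
open import Data.List.Relation.Unary.All using (All)
open import Data.Vec using (drop)
open import Data.Fin.Subset using (Subset; _∈_; _∉_; _⊆_; _∪_; _∩_; ⋃; ⁅_⁆; Nonempty)
  renaming (⊥ to ∅; ⊤ to Full)
open import Relation.Nullary using (¬_)
open import Relation.Binary.Core using (Rel)
open import Relation.Binary.Bundles using (Setoid)
open import Relation.Binary.Structures using (IsPartialOrder)
open import Relation.Binary.PropositionalEquality using (_≡_; refl; sym; trans)
open import Function.Bundles using (_⇔_)

-- M = Fin m, K = Fin k, and M ∪ K (disjoint) = Fin (m + k),
-- with a ∈ M sitting as  a ↑ˡ k  and  x ∈ K sitting as  m ↑ʳ x.

BRel : ℕ → Set
BRel n = Fin n → Fin n → Bool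

⟦_⟧ : ∀ {n} → BRel n → Rel (Fin n) _
⟦ R ⟧ x y = T (R x y)

IsPoset : ∀ {n} → BRel n → Set
IsPoset P = IsPartialOrder _≡_ ⟦ P ⟧

IsDownset : ∀ {k} → BRel k → Subset k → Set
IsDownset P D = ∀ x y → T (P y x) → x ∈ D → y ∈ D

IsUpset : ∀ {k} → BRel k → Subset k → Set
IsUpset P U = ∀ x y → T (P x y) → x ∈ U → y ∈ U

PWSetoid : (A I B : Set) (Dom : I → Set) (app : A → I → B) → Setoid _ _
PWSetoid A I B Dom app = record
  { Carrier = A
  ; _≈_ = λ a a' → ∀ i → Dom i → app a i ≡ app a' i
  ; isEquivalence = record
    { refl = λ i _ → refl
    ; sym = λ p i d → sym (p i d)
    ; trans = λ p q i d → trans (p i d) (q i d)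
    }
  }

Always : ∀ {I : Set} → I → Set
Always _ = Fin 1

InM : ∀ m k → Fin (m + k) → Set
InM m k z = ∃[ a ] z ≡ a ↑ˡ k

IsMinimal : ∀ {n} → BRel n → Fin n → Set
IsMinimal Q x = ∀ y → T (Q y x) → y ≡ x

IsE : ∀ m k → BRel k → BRel (m + k) → Set
IsE m k P Q =
  IsPoset Q
  × (∀ z → IsMinimal Q z ⇔ InM m k z)
  × (∀ x y → T (Q (m ↑ʳ x) (m ↑ʳ y)) ⇔ T (P x y))

𝓔 : ∀ m k → BRel k → Setoid _ _
𝓔 m k P = PWSetoid (Σ (BRel (m + k)) (IsE m k P)) (Fin (m + k) × Fin (m + k)) Bool
  Always (λ { (Q , _) (x , y) → Q x y })

IsF : ∀ m k → BRel k → (Fin k → Subset m) → Set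
IsF m k P f = (∀ x → Nonempty (f x)) × (∀ x y → T (P x y) → f x ⊆ f y)

𝓕 : ∀ m k → BRel k → Setoid _ _
𝓕 m k P = PWSetoid (Σ (Fin k → Subset m) (IsF m k P)) (Fin k) (Subset m)
  Always (λ f x → proj₁ f x)

IsG : ∀ m k → BRel k → (Fin m → Subset k) → Set
IsG m k P g = (∀ a → IsUpset P (g a)) × (⋃ (map g (allFin m)) ≡ Full)

𝓖 : ∀ m k → BRel k → Setoid _ _
𝓖 m k P = PWSetoid (Σ (Fin m → Subset k) (IsG m k P)) (Fin m) (Subset k)
  Always (λ g a → proj₁ g a)

-- 𝓗(M,P) = { h : 𝓓(P) → 𝓟(M) | h preserves unions, h D = ∅ ⇒ D = ∅ }
-- h is given as a function on all subsets of K, but only its values on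
-- downsets matter (the setoid identifies h, h' agreeing on 𝓓(P)).
-- Since 𝓓(P) is finite, "preserves unions" = preserves unions of all
-- finite families (lists), including the empty family.

IsH : ∀ m k → BRel k → (Subset k → Subset m) → Set
IsH m k P h =
  (∀ (Ds : List (Subset k)) → All (IsDownset P) Ds → h (⋃ Ds) ≡ ⋃ (map h Ds))
  × (∀ D → IsDownset P D → h D ≡ ∅ → D ≡ ∅)

𝓗 : ∀ m k → BRel k → Setoid _ _
𝓗 m k P = PWSetoid (Σ (Subset k → Subset m) (IsH m k P)) (Subset k) (Subset m)
  (IsDownset P) (λ h D → proj₁ h D)

IsI : ∀ m k → BRel k → (Fin m → Fin k → Bool) → Set
IsI m k P R =
  (∀ a x y → T (R a x) → T (P x y) → T (R a y))
  × (∀ y → ∃[ a ] T (R a y))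

𝓘 : ∀ m k → BRel k → Setoid _ _
𝓘 m k P = PWSetoid (Σ (Fin m → Fin k → Bool) (IsI m k P)) (Fin m × Fin k) Bool
  Always (λ { (R , _) (a , x) → R a x })

-- Topologies on a finite set Fin n, given by their predicate of open sets.
-- (Finite, so closure under arbitrary unions = under finite unions.)

IsTopology : ∀ {n} → (Subset n → Bool) → Set
IsTopology {n} τ =
  (∀ (Us : List (Subset n)) → All (λ U → T (τ U)) Us → T (τ (⋃ Us)))
  × T (τ Full)
  × (∀ U V → T (τ U) → T (τ V) → T (τ (U ∩ V)))

IsT0 : ∀ {n} → (Subset n → Bool) → Set
IsT0 {n} τ = ∀ (x y : Fin n) → ¬ x ≡ y →
  ∃[ U ] T (τ U) × ((x ∈ U × y ∉ U) ⊎ (y ∈ U × x ∉ U))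

IsTopE : ∀ m k → BRel k → (Subset (m + k) → Bool) → Set
IsTopE m k P τ =
  IsTopology τ
  × IsT0 τ
  × (∀ (S : Subset k) → (∃[ U ] T (τ U) × drop m U ≡ S) ⇔ IsDownset P S)
  × (∀ z → T (τ ⁅ z ⁆) ⇔ InM m k z)

𝓣 : ∀ m k → BRel k → Setoid _ _
𝓣 m k P = PWSetoid (Σ (Subset (m + k) → Bool) (IsTopE m k P)) (Subset (m + k)) Bool
  Always (λ τ U → proj₁ τ U)

-- Everything factors through 𝓘. An upward closed relation R ⊆ M × K covering K is the same
-- thing as its columns (𝓕), its rows (𝓖), or the union-preserving map D ↦ R⁻¹[D] on
-- downsets (𝓗); the latter is recovered from its values on principal downsets, since every
-- downset is the union of the principal downsets of its elements. An order in 𝓔 is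
-- determined by R(a, x) = (a ≤ x): M is an antichain, nothing of K lies below M, and K is
-- covered by R because every point of a finite poset lies above a minimal one. Finally 𝓔 ≅ 𝓣
-- is the finite Alexandrov correspondence between partial orders (via downsets) and T₀
-- topologies (via the specialisation order), under which minimal points are exactly the
-- isolated points and the order induced on K matches the subspace topology on K.

module Submission where

open import Defs
open import Data.Nat using (ℕ; zero; suc; _+_)
open import Data.Bool using (Bool; true; false; T)
open import Data.Bool.Properties using (T-≡)
open import Data.Unit using (tt)
open import Data.Empty using (⊥-elim)
open import Data.Product using (∃-syntax; _×_; _,_; proj₁; proj₂)
open import Data.Sum as Sum using (_⊎_; inj₁; inj₂; [_,_]′)
open import Data.Fin as Fin using (Fin; _↑ˡ_; _↑ʳ_; splitAt; _≟_)
open import Data.Fin.Properties using (any?; all?; splitAt-↑ˡ; splitAt-↑ʳ; ↑ˡ-injective)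
open import Data.Fin.Induction using (po-wellFounded)
open import Data.Fin.Subset using (Subset; _∈_; _∉_; _⊆_; _∪_; _∩_; ⋃; ⋂; ⁅_⁆)
  renaming (⊥ to ∅; ⊤ to Full)
open import Data.Fin.Subset.Properties
  using (_∈?_; ⊆-antisym; ∉⊥; ∈⊤; Empty-unique; nonempty?; x∈p∪q⁻; x∈p∪q⁺; x∈p∩q⁻; x∈p∩q⁺;
         anySubset?; x∈⁅x⁆; x∈⁅y⁆⇒x≡y; drop-there; p⊆p∪q; q⊆p∪q)
open import Data.List using (List; []; _∷_; map; filter; allFin)
open import Data.List.Properties using (foldr-preservesᵇ; map-∘)
open import Data.List.Relation.Unary.All as All using (All; []; _∷_)
import Data.List.Relation.Unary.All.Properties as Allₚ
open import Data.List.Relation.Unary.Any using (here; there)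
open import Data.List.Membership.Propositional using () renaming (_∈_ to _∈ˡ_)
open import Data.List.Membership.Propositional.Properties
  using (∈-map⁺; ∈-map⁻; ∈-filter⁺; ∈-filter⁻; ∈-allFin)
open import Data.Vec using (Vec; lookup; tabulate; drop; _++_)
  renaming ([] to []ᵥ; _∷_ to _∷ᵥ_; there to thereᵥ)
open import Data.Vec.Properties
  using (lookup∘tabulate; tabulate∘lookup; tabulate-cong; []=⇒lookup; lookup⇒[]=; lookup-++ˡ; lookup-replicate)
open import Induction.WellFounded using (Acc; acc)
open import Relation.Nullary using (¬_; Dec; yes; no)
open import Relation.Nullary.Decidable
  using (⌊_⌋; toWitness; fromWitness; T?; _×-dec_; _→-dec_; ¬?; decidable-stable)
open import Relation.Binary.Bundles using (Setoid)
open import Relation.Binary.Definitions using (Reflexive; Transitive; Antisymmetric)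
open import Relation.Binary.Structures using (IsPartialOrder; IsPreorder)
import Relation.Binary.Construct.NonStrictToStrict as ToStrict
open import Relation.Binary.PropositionalEquality
  using (_≡_; _≢_; refl; sym; trans; cong; subst; isEquivalence; module ≡-Reasoning)
open import Function.Base using (id; _∘_)
open import Function.Bundles using (Inverse; _⇔_; mk⇔; module Equivalence)
open Equivalence using (to; from)
open import Function.Definitions using (Congruent; StrictlyInverseˡ; StrictlyInverseʳ)
import Function.Consequences.Setoid as Consequences
open import Function.Construct.Composition using (_⇔-∘_) renaming (inverse to _⨾_)

T-ext : ∀ {a b : Bool} → (T a → T b) → (T b → T a) → a ≡ b
T-ext {false} {false} _ _ = refl
T-ext {false} {true} _ g = ⊥-elim (g tt)
T-ext {true} {false} f _ = ⊥-elim (f tt)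
T-ext {true} {true} _ _ = refl

mkInverse : ∀ {a ℓ₁ b ℓ₂} {S : Setoid a ℓ₁} {R : Setoid b ℓ₂}
  (to : Setoid.Carrier S → Setoid.Carrier R) (from : Setoid.Carrier R → Setoid.Carrier S) →
  Congruent (Setoid._≈_ S) (Setoid._≈_ R) to → Congruent (Setoid._≈_ R) (Setoid._≈_ S) from →
  StrictlyInverseˡ (Setoid._≈_ R) to from → StrictlyInverseʳ (Setoid._≈_ S) to from →
  Inverse S R
mkInverse {S = S} {R} to from to-cong from-cong invˡ invʳ = record
  { to = to ; from = from ; to-cong = to-cong ; from-cong = from-cong
  ; inverse = strictlyInverseˡ⇒inverseˡ to-cong invˡ , strictlyInverseʳ⇒inverseʳ from-cong invʳ
  }
  where open Consequences S R

module _ {n : ℕ} where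

  ∈⇔T-lookup : ∀ {p : Subset n} {x} → x ∈ p ⇔ T (lookup p x)
  ∈⇔T-lookup {p} {x} = mk⇔
    (λ x∈p → subst T (sym ([]=⇒lookup x∈p)) tt)
    (λ t → lookup⇒[]= x p (to T-≡ t))

  ∈-tabulate : ∀ {f : Fin n → Bool} {x} → x ∈ tabulate f ⇔ T (f x)
  ∈-tabulate {f} {x} = mk⇔
    (subst T (lookup∘tabulate f x) ∘ to ∈⇔T-lookup)
    (from ∈⇔T-lookup ∘ subst T (sym (lookup∘tabulate f x)))

  ∈-⋃⁺ : ∀ {Us : List (Subset n)} {U x} → U ∈ˡ Us → x ∈ U → x ∈ ⋃ Us
  ∈-⋃⁺ (here refl) x∈U = x∈p∪q⁺ (inj₁ x∈U)
  ∈-⋃⁺ {U′ ∷ _} (there U∈Us) x∈U = x∈p∪q⁺ {p = U′} (inj₂ (∈-⋃⁺ U∈Us x∈U))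

  ∈-⋃⁻ : ∀ (Us : List (Subset n)) {x} → x ∈ ⋃ Us → ∃[ U ] U ∈ˡ Us × x ∈ U
  ∈-⋃⁻ [] x∈⋃ = ⊥-elim (∉⊥ x∈⋃)
  ∈-⋃⁻ (U ∷ Us) x∈⋃ with x∈p∪q⁻ U (⋃ Us) x∈⋃
  ... | inj₁ x∈U = U , here refl , x∈U
  ... | inj₂ x∈⋃Us = let (V , V∈Us , x∈V) = ∈-⋃⁻ Us x∈⋃Us in V , there V∈Us , x∈V

  ∈-⋃-map⁺ : ∀ {A : Set} {f : A → Subset n} {xs i y} → i ∈ˡ xs → y ∈ f i → y ∈ ⋃ (map f xs)
  ∈-⋃-map⁺ i∈xs = ∈-⋃⁺ (∈-map⁺ _ i∈xs)

  ∈-⋃-map⁻ : ∀ {A : Set} (f : A → Subset n) xs {y} →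
    y ∈ ⋃ (map f xs) → ∃[ i ] i ∈ˡ xs × y ∈ f i
  ∈-⋃-map⁻ f xs y∈⋃ with ∈-⋃⁻ (map f xs) y∈⋃
  ... | U , U∈map , y∈U with ∈-map⁻ f U∈map
  ...   | i , i∈xs , refl = i , i∈xs , y∈U

  ∈-⋂ : ∀ {Us : List (Subset n)} {x} → x ∈ ⋂ Us → All (x ∈_) Us
  ∈-⋂ {[]} _ = []
  ∈-⋂ {U ∷ Us} x∈⋂ = let (x∈U , x∈⋂Us) = x∈p∩q⁻ U (⋂ Us) x∈⋂ in
    x∈U ∷ ∈-⋂ x∈⋂Us

  ⋂-∈ : ∀ {Us : List (Subset n)} {x} → All (x ∈_) Us → x ∈ ⋂ Us
  ⋂-∈ = foldr-preservesᵇ (λ x∈U x∈V → x∈p∩q⁺ (x∈U , x∈V)) ∈⊤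

  elements : Subset n → List (Fin n)
  elements D = filter (_∈? D) (allFin n)

  ∈-elements : ∀ {D x} → x ∈ˡ elements D ⇔ x ∈ D
  ∈-elements {D} {x} = mk⇔
    (proj₂ ∘ ∈-filter⁻ (_∈? D) {xs = allFin n})
    (∈-filter⁺ (_∈? D) (∈-allFin x))

drop-++ : ∀ {A : Set} m {k} (xs : Vec A m) (ys : Vec A k) → drop m (xs ++ ys) ≡ ys
drop-++ zero []ᵥ ys = refl
drop-++ (suc m) (x ∷ᵥ xs) ys = drop-++ m xs ys

∈-drop : ∀ m {k} {U : Subset (m + k)} {x} → x ∈ drop m U ⇔ m ↑ʳ x ∈ U
∈-drop zero = mk⇔ id id
∈-drop (suc m) {U = b ∷ᵥ U} = mk⇔ (thereᵥ ∘ to (∈-drop m)) (from (∈-drop m) ∘ drop-there)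

mkIsPoset : ∀ {n} {Q : BRel n} →
  Reflexive ⟦ Q ⟧ → Transitive ⟦ Q ⟧ → Antisymmetric _≡_ ⟦ Q ⟧ → IsPoset Q
mkIsPoset Q-refl Q-trans Q-antisym = record
  { isPreorder = record
    { isEquivalence = isEquivalence ; reflexive = λ { refl → Q-refl } ; trans = Q-trans }
  ; antisym = Q-antisym
  }

↓ : ∀ {n} → BRel n → Fin n → Subset n
↓ Q x = tabulate (λ y → Q y x)

∈-↓ : ∀ {n} (Q : BRel n) {x y} → y ∈ ↓ Q x ⇔ T (Q y x)
∈-↓ Q = ∈-tabulate

module _ {n : ℕ} {Q : BRel n} where

  ↓-isDownset : Transitive ⟦ Q ⟧ → ∀ x → IsDownset Q (↓ Q x)
  ↓-isDownset Q-trans x y z z≤y y∈↓x =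
    from (∈-↓ Q) (Q-trans z≤y (to (∈-↓ Q) y∈↓x))

  ⋃-↓-elements : Reflexive ⟦ Q ⟧ → ∀ {D} → IsDownset Q D → ⋃ (map (↓ Q) (elements D)) ≡ D
  ⋃-↓-elements Q-refl {D} D-down = ⊆-antisym
    (λ y∈⋃ → let (x , x∈D , y∈↓x) = ∈-⋃-map⁻ (↓ Q) (elements D) y∈⋃ in
      D-down x _ (to (∈-↓ Q) y∈↓x) (to ∈-elements x∈D))
    (λ y∈D → ∈-⋃-map⁺ (from ∈-elements y∈D) (from (∈-↓ Q) Q-refl))

  ∅-isDownset : IsDownset Q ∅
  ∅-isDownset _ _ _ x∈∅ = ⊥-elim (∉⊥ x∈∅)

  Full-isDownset : IsDownset Q Full
  Full-isDownset _ _ _ _ = ∈⊤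

  ∪-isDownset : ∀ {U V} → IsDownset Q U → IsDownset Q V → IsDownset Q (U ∪ V)
  ∪-isDownset {U} {V} U-down V-down x y y≤x x∈U∪V =
    x∈p∪q⁺ ([ inj₁ ∘ U-down x y y≤x , inj₂ ∘ V-down x y y≤x ]′ (x∈p∪q⁻ U V x∈U∪V))

  ∩-isDownset : ∀ {U V} → IsDownset Q U → IsDownset Q V → IsDownset Q (U ∩ V)
  ∩-isDownset {U} {V} U-down V-down x y y≤x x∈U∩V =
    let (x∈U , x∈V) = x∈p∩q⁻ U V x∈U∩V in x∈p∩q⁺ (U-down x y y≤x x∈U , V-down x y y≤x x∈V)

  ⁅⁆-isDownset⇔isMinimal : ∀ {z} → IsDownset Q ⁅ z ⁆ ⇔ IsMinimal Q z
  ⁅⁆-isDownset⇔isMinimal {z} = mk⇔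
    (λ ⁅z⁆-down y y≤z → x∈⁅y⁆⇒x≡y z (⁅z⁆-down z y y≤z (x∈⁅x⁆ z)))
    (λ z-min x y y≤x x∈⁅z⁆ → let x≡z = x∈⁅y⁆⇒x≡y z x∈⁅z⁆ in
      subst (_∈ ⁅ z ⁆) (sym (z-min y (subst (T ∘ Q y) x≡z y≤x))) (x∈⁅x⁆ z))

  -- A strictly smaller element is found decidably; well-foundedness of the strict order ends the descent.
  minimal-below : IsPoset Q → ∀ z → ∃[ w ] T (Q w z) × IsMinimal Q w
  minimal-below Q-po z = descend z (po-wellFounded Q-po z)
    where
    open IsPartialOrder Q-po using () renaming (refl to Q-refl; trans to Q-trans)
    descend : ∀ z → Acc (ToStrict._<_ _≡_ ⟦ Q ⟧) z → ∃[ w ] T (Q w z) × IsMinimal Q w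
    descend z (acc below) with any? (λ y → T? (Q y z) ×-dec ¬? (y ≟ z))
    ... | yes (y , y<z) = let (w , w≤y , w-min) = descend y (below y<z) in
      w , Q-trans w≤y (proj₁ y<z) , w-min
    ... | no nothing-below = z , Q-refl , λ y y≤z →
      decidable-stable (y ≟ z) (λ y≢z → nothing-below (y , y≤z , y≢z))

-- Finite Alexandrov topologies

module _ {n : ℕ} where

  downset? : (Q : BRel n) (U : Subset n) → Dec (IsDownset Q U)
  downset? Q U = all? λ x → all? λ y → T? (Q y x) →-dec (x ∈? U →-dec y ∈? U)

  downsets : BRel n → Subset n → Bool
  downsets Q U = ⌊ downset? Q U ⌋

  T-downsets : ∀ {Q U} → T (downsets Q U) ⇔ IsDownset Q U
  T-downsets = mk⇔ toWitness fromWitness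

  downsets-cong : ∀ {Q Q′ : BRel n} → (∀ x y → Q x y ≡ Q′ x y) →
    ∀ U → downsets Q U ≡ downsets Q′ U
  downsets-cong Q≗Q′ U = T-ext
    (λ U-down → from T-downsets λ x y y≤x → to T-downsets U-down x y (subst T (sym (Q≗Q′ y x)) y≤x))
    (λ U-down → from T-downsets λ x y y≤x → to T-downsets U-down x y (subst T (Q≗Q′ y x) y≤x))

  downsets-isTopology : (Q : BRel n) → IsTopology (downsets Q)
  downsets-isTopology Q =
      (λ Us Us-down → from T-downsets
         (foldr-preservesᵇ ∪-isDownset ∅-isDownset (All.map (to T-downsets) Us-down)))
    , from T-downsets Full-isDownset
    , (λ U V U-down V-down → from T-downsets
         (∩-isDownset (to T-downsets U-down) (to T-downsets V-down)))

  downsets-isT0 : ∀ {Q : BRel n} → IsPoset Q → IsT0 (downsets Q)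
  downsets-isT0 {Q} Q-po x y x≢y = separate (T? (Q x y))
    where
    open IsPartialOrder Q-po using () renaming (refl to Q-refl; trans to Q-trans; antisym to Q-antisym)
    ↓-open : ∀ z → T (downsets Q (↓ Q z))
    ↓-open z = from T-downsets (↓-isDownset Q-trans z)
    separate : Dec (T (Q x y)) → ∃[ U ] T (downsets Q U) × ((x ∈ U × y ∉ U) ⊎ (y ∈ U × x ∉ U))
    separate (yes x≤y) = ↓ Q x , ↓-open x ,
      inj₁ (from (∈-↓ Q) Q-refl , λ y∈↓x → x≢y (Q-antisym x≤y (to (∈-↓ Q) y∈↓x)))
    separate (no x≰y) = ↓ Q y , ↓-open y , inj₂ (from (∈-↓ Q) Q-refl , x≰y ∘ to (∈-↓ Q))

  separating? : (τ : Subset n → Bool) (x y : Fin n) → Dec (∃[ U ] T (τ U) × y ∈ U × x ∉ U)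
  separating? τ x y = anySubset? λ U → T? (τ U) ×-dec y ∈? U ×-dec ¬? (x ∈? U)

  specialisation : (Subset n → Bool) → BRel n
  specialisation τ x y = ⌊ ¬? (separating? τ x y) ⌋

  T-specialisation : ∀ {τ x y} → T (specialisation τ x y) ⇔ (∀ U → T (τ U) → y ∈ U → x ∈ U)
  T-specialisation {τ} {x} {y} = mk⇔
    (λ x≤y U U-open y∈U → decidable-stable (x ∈? U) λ x∉U →
      toWitness x≤y (U , U-open , y∈U , x∉U))
    (λ every → fromWitness λ (U , U-open , y∈U , x∉U) → x∉U (every U U-open y∈U))

  specialisation-cong : ∀ {τ τ′ : Subset n → Bool} → (∀ U → τ U ≡ τ′ U) →
    ∀ x y → specialisation τ x y ≡ specialisation τ′ x y
  specialisation-cong τ≗τ′ x y = T-ext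
    (λ x≤y → from T-specialisation λ U → to T-specialisation x≤y U ∘ subst T (sym (τ≗τ′ U)))
    (λ x≤y → from T-specialisation λ U → to T-specialisation x≤y U ∘ subst T (τ≗τ′ U))

  specialisation-isPoset : ∀ {τ} → IsT0 τ → IsPoset (specialisation τ)
  specialisation-isPoset {τ} τ-T0 = mkIsPoset
    (from T-specialisation λ _ _ y∈U → y∈U)
    (λ x≤y y≤z → from T-specialisation λ U U-open z∈U →
      to T-specialisation x≤y U U-open (to T-specialisation y≤z U U-open z∈U))
    antisym
    where
    antisym : ∀ {x y} → T (specialisation τ x y) → T (specialisation τ y x) → x ≡ y
    antisym {x} {y} x≤y y≤x with x ≟ y
    ... | yes x≡y = x≡y
    ... | no x≢y with τ-T0 x y x≢y
    ...   | U , U-open , inj₁ (x∈U , y∉U) = ⊥-elim (y∉U (to T-specialisation y≤x U U-open x∈U))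
    ...   | U , U-open , inj₂ (y∈U , x∉U) = ⊥-elim (x∉U (to T-specialisation x≤y U U-open y∈U))

  module _ {τ : Subset n → Bool} (τ-top : IsTopology τ) where

    private
      ⋃-open : ∀ {Us} → All (T ∘ τ) Us → T (τ (⋃ Us))
      ⋃-open {Us} = proj₁ τ-top Us
      Full-open : T (τ Full)
      Full-open = proj₁ (proj₂ τ-top)
      ∩-open : ∀ {U V} → T (τ U) → T (τ V) → T (τ (U ∩ V))
      ∩-open = proj₂ (proj₂ τ-top) _ _

    separator : Fin n → Fin n → Subset n
    separator y x with separating? τ x y
    ... | yes (U , _) = U
    ... | no _ = Full

    separator-open : ∀ y x → T (τ (separator y x))
    separator-open y x with separating? τ x y
    ... | yes (_ , U-open , _) = U-open
    ... | no _ = Full-open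

    ∈-separator : ∀ y x → y ∈ separator y x
    ∈-separator y x with separating? τ x y
    ... | yes (_ , _ , y∈U , _) = y∈U
    ... | no _ = ∈⊤

    separator-∋⇒≤ : ∀ y x → x ∈ separator y x → T (specialisation τ x y)
    separator-∋⇒≤ y x x∈U with separating? τ x y
    ... | yes (_ , _ , _ , x∉U) = ⊥-elim (x∉U x∈U)
    ... | no _ = tt

    -- The smallest open neighbourhood of y is the intersection of its separators.
    ↓-specialisation-open : ∀ y → T (τ (↓ (specialisation τ) y))
    ↓-specialisation-open y = subst (T ∘ τ) ⋂separators≡↓
      (foldr-preservesᵇ {P = T ∘ τ} ∩-open Full-open (Allₚ.tabulate⁺ (separator-open y)))
      where
      ⋂separators≡↓ : ⋂ (Data.List.tabulate (separator y)) ≡ ↓ (specialisation τ) y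
      ⋂separators≡↓ = ⊆-antisym
        (λ {x} x∈⋂ → from (∈-↓ (specialisation τ)) (separator-∋⇒≤ y x (Allₚ.tabulate⁻ (∈-⋂ x∈⋂) x)))
        (λ x∈↓y → ⋂-∈ (Allₚ.tabulate⁺ λ x′ → to T-specialisation (to (∈-↓ (specialisation τ)) x∈↓y)
          (separator y x′) (separator-open y x′) (∈-separator y x′)))

    downsets-specialisation : ∀ U → downsets (specialisation τ) U ≡ τ U
    downsets-specialisation U = T-ext
      (λ U-down → subst (T ∘ τ)
        (⋃-↓-elements (from T-specialisation λ _ _ y∈V → y∈V) (to T-downsets U-down))
        (⋃-open (Allₚ.map⁺ (All.universal ↓-specialisation-open (elements U)))))
      (λ U-open → from T-downsets λ x y y≤x x∈U → to T-specialisation y≤x U U-open x∈U)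

  specialisation-downsets : ∀ {Q : BRel n} → IsPreorder _≡_ ⟦ Q ⟧ →
    ∀ x y → specialisation (downsets Q) x y ≡ Q x y
  specialisation-downsets {Q} Q-pre x y = T-ext
    (λ x≤y → to (∈-↓ Q) (to T-specialisation x≤y
      (↓ Q y) (from T-downsets (↓-isDownset Q-trans y)) (from (∈-↓ Q) Q-refl)))
    (λ x≤y → from T-specialisation λ U U-down y∈U → to T-downsets U-down y x x≤y y∈U)
    where open IsPreorder Q-pre using () renaming (refl to Q-refl; trans to Q-trans)

module _ {k m : ℕ} {P : BRel k} (P-pre : IsPreorder _≡_ ⟦ P ⟧) {h : Subset k → Subset m}
  (h-⋃ : ∀ Ds → All (IsDownset P) Ds → h (⋃ Ds) ≡ ⋃ (map h Ds)) where

  open IsPreorder P-pre using () renaming (refl to P-refl; trans to P-trans)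

  -- A downset is the union of the principal downsets of its elements.
  h-downset≡⋃ : ∀ {D} → IsDownset P D → h D ≡ ⋃ (map (h ∘ ↓ P) (elements D))
  h-downset≡⋃ {D} D-down = begin
    h D                       ≡⟨ cong h (sym (⋃-↓-elements P-refl D-down)) ⟩
    h (⋃ (map (↓ P) xs))      ≡⟨ h-⋃ _ (Allₚ.map⁺ (All.universal (↓-isDownset P-trans) xs)) ⟩
    ⋃ (map h (map (↓ P) xs))  ≡⟨ cong ⋃ (sym (map-∘ xs)) ⟩
    ⋃ (map (h ∘ ↓ P) xs)      ∎
    where
    open ≡-Reasoning
    xs : List (Fin k)
    xs = elements D

  ∈-h-downset : ∀ {D} → IsDownset P D → ∀ {a} → a ∈ h D ⇔ (∃[ x ] x ∈ D × a ∈ h (↓ P x))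
  ∈-h-downset {D} D-down {a} = mk⇔
    (λ a∈hD → let (x , x∈D , a∈h↓x) = ∈-⋃-map⁻ (h ∘ ↓ P) (elements D)
                                         (subst (a ∈_) (h-downset≡⋃ D-down) a∈hD)
              in x , to ∈-elements x∈D , a∈h↓x)
    (λ (x , x∈D , a∈h↓x) → subst (a ∈_) (sym (h-downset≡⋃ D-down))
      (∈-⋃-map⁺ (from ∈-elements x∈D) a∈h↓x))

module _ {m k : ℕ} where

  image : (Fin m → Fin k → Bool) → Subset k → Subset m
  image R D = tabulate λ a → ⌊ any? (λ x → x ∈? D ×-dec T? (R a x)) ⌋

  ∈-image : ∀ {R D a} → a ∈ image R D ⇔ (∃[ x ] x ∈ D × T (R a x))
  ∈-image = mk⇔ (toWitness ∘ to ∈-tabulate) (from ∈-tabulate ∘ fromWitness)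

  image-cong : ∀ {R R′} → (∀ a x → R a x ≡ R′ a x) → ∀ D → image R D ≡ image R′ D
  image-cong R≗R′ D = ⊆-antisym
    (λ {a} a∈ → let (x , x∈D , Rax) = to ∈-image a∈ in
      from ∈-image (x , x∈D , subst T (R≗R′ a x) Rax))
    (λ {a} a∈ → let (x , x∈D , Rax) = to ∈-image a∈ in
      from ∈-image (x , x∈D , subst T (sym (R≗R′ a x)) Rax))

  image-∅ : ∀ R → image R ∅ ≡ ∅
  image-∅ R = Empty-unique λ (a , a∈) → let (x , x∈∅ , _) = to ∈-image a∈ in ∉⊥ x∈∅

  image-mono : ∀ R {D E} → D ⊆ E → image R D ⊆ image R E
  image-mono R D⊆E a∈ = let (x , x∈D , Rax) = to ∈-image a∈ in from ∈-image (x , D⊆E x∈D , Rax)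

  image-∪ : ∀ R D E → image R (D ∪ E) ≡ image R D ∪ image R E
  image-∪ R D E = ⊆-antisym
    (λ a∈ → let (x , x∈D∪E , Rax) = to ∈-image a∈ in x∈p∪q⁺
      (Sum.map (λ x∈D → from ∈-image (x , x∈D , Rax)) (λ x∈E → from ∈-image (x , x∈E , Rax))
        (x∈p∪q⁻ D E x∈D∪E)))
    (λ a∈ → [ image-mono R (p⊆p∪q E) , image-mono R (q⊆p∪q D E) ]′ (x∈p∪q⁻ (image R D) (image R E) a∈))

  image-⋃ : ∀ R Ds → image R (⋃ Ds) ≡ ⋃ (map (image R) Ds)
  image-⋃ R [] = image-∅ R
  image-⋃ R (D ∷ Ds) = trans (image-∪ R D (⋃ Ds)) (cong (image R D ∪_) (image-⋃ R Ds))

-- The disjoint union M ∪ K = Fin (m + k)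

data Side (m k : ℕ) : Fin (m + k) → Set where
  inM : (a : Fin m) → Side m k (a ↑ˡ k)
  inK : (x : Fin k) → Side m k (m ↑ʳ x)

side : ∀ m k (z : Fin (m + k)) → Side m k z
side zero k z = inK z
side (suc m) k Fin.zero = inM Fin.zero
side (suc m) k (Fin.suc z) with side m k z
... | inM a = inM (Fin.suc a)
... | inK x = inK x

↑ˡ≢↑ʳ : ∀ m k {a : Fin m} {x : Fin k} → a ↑ˡ k ≢ m ↑ʳ x
↑ˡ≢↑ʳ m k {a} {x} a≡x
  with () ← trans (sym (splitAt-↑ˡ m a k)) (trans (cong (splitAt m) a≡x) (splitAt-↑ʳ m k x))

↑ˡ-∈-Full++ : ∀ {m k} (S : Subset k) a → a ↑ˡ k ∈ Full {m} ++ S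
↑ˡ-∈-Full++ S a = from ∈⇔T-lookup (subst T (sym (trans (lookup-++ˡ Full S a) (lookup-replicate a true))) tt)

-- The correspondences

module Correspondences (m k : ℕ) (P : BRel k) (P-po : IsPoset P) where

  open IsPartialOrder P-po using ()
    renaming (isPreorder to P-pre; refl to P-refl; trans to P-trans; antisym to P-antisym)

  𝓘↔𝓕 : Inverse (𝓘 m k P) (𝓕 m k P)
  𝓘↔𝓕 = mkInverse {S = 𝓘 m k P} {R = 𝓕 m k P} columns fromColumns
    (λ R≈R′ x _ → tabulate-cong λ a → R≈R′ (a , x) Fin.zero)
    (λ f≈f′ (a , x) _ → cong (λ s → lookup s a) (f≈f′ x Fin.zero))
    (λ (f , _) x _ → tabulate∘lookup (f x))
    (λ (R , _) (a , x) _ → lookup∘tabulate (λ a → R a x) a)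
    where
    columns : Setoid.Carrier (𝓘 m k P) → Setoid.Carrier (𝓕 m k P)
    columns (R , R-up , R-covers) =
        (λ x → tabulate λ a → R a x)
      , (λ x → let (a , Rax) = R-covers x in a , from ∈-tabulate Rax)
      , (λ x y x≤y a∈ → from ∈-tabulate (R-up _ x y (to ∈-tabulate a∈) x≤y))
    fromColumns : Setoid.Carrier (𝓕 m k P) → Setoid.Carrier (𝓘 m k P)
    fromColumns (f , f-nonempty , f-mono) =
        (λ a x → lookup (f x) a)
      , (λ a x y Rax x≤y → to ∈⇔T-lookup (f-mono x y x≤y (from ∈⇔T-lookup Rax)))
      , (λ y → let (a , a∈fy) = f-nonempty y in a , to ∈⇔T-lookup a∈fy)

  𝓘↔𝓖 : Inverse (𝓘 m k P) (𝓖 m k P)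
  𝓘↔𝓖 = mkInverse {S = 𝓘 m k P} {R = 𝓖 m k P} rows fromRows
    (λ R≈R′ a _ → tabulate-cong λ x → R≈R′ (a , x) Fin.zero)
    (λ g≈g′ (a , x) _ → cong (λ s → lookup s x) (g≈g′ a Fin.zero))
    (λ (g , _) a _ → tabulate∘lookup (g a))
    (λ (R , _) (a , x) _ → lookup∘tabulate (R a) x)
    where
    rows : Setoid.Carrier (𝓘 m k P) → Setoid.Carrier (𝓖 m k P)
    rows (R , R-up , R-covers) =
        (λ a → tabulate (R a))
      , (λ a x y x≤y x∈ → from ∈-tabulate (R-up a x y (to ∈-tabulate x∈) x≤y))
      , ⊆-antisym (λ _ → ∈⊤) (λ {y} _ → let (a , Ray) = R-covers y in
          ∈-⋃-map⁺ (∈-allFin a) (from ∈-tabulate Ray))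
    fromRows : Setoid.Carrier (𝓖 m k P) → Setoid.Carrier (𝓘 m k P)
    fromRows (g , g-up , g-covers) =
        (λ a x → lookup (g a) x)
      , (λ a x y Rax x≤y → to ∈⇔T-lookup (g-up a x y x≤y (from ∈⇔T-lookup Rax)))
      , (λ y → let (a , _ , y∈ga) = ∈-⋃-map⁻ g (allFin m) (subst (y ∈_) (sym g-covers) ∈⊤) in
          a , to ∈⇔T-lookup y∈ga)

  𝓘↔𝓗 : Inverse (𝓘 m k P) (𝓗 m k P)
  𝓘↔𝓗 = mkInverse {S = 𝓘 m k P} {R = 𝓗 m k P} images fromImages
    (λ R≈R′ D _ → image-cong (λ a x → R≈R′ (a , x) Fin.zero) D)
    (λ h≈h′ (a , x) _ → cong (λ s → lookup s a) (h≈h′ (↓ P x) (↓P-isDownset x)))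
    (λ (h , h-⋃ , _) D D-down → ⊆-antisym
      (λ a∈ → let (x , x∈D , a∈h↓x) = to ∈-image a∈ in
        from (∈-h-downset P-pre h-⋃ D-down) (x , x∈D , from ∈⇔T-lookup a∈h↓x))
      (λ a∈hD → let (x , x∈D , a∈h↓x) = to (∈-h-downset P-pre h-⋃ D-down) a∈hD in
        from ∈-image (x , x∈D , to ∈⇔T-lookup a∈h↓x)))
    (λ (R , R-up , _) (a , x) _ → T-ext
      (λ a∈ → let (y , y∈↓x , Ray) = to (∈-image {R = R}) (from ∈⇔T-lookup a∈) in
        R-up a y x Ray (to (∈-↓ P) y∈↓x))
      (λ Rax → to ∈⇔T-lookup (from (∈-image {R = R}) (x , from (∈-↓ P) P-refl , Rax))))
    where
    ↓P-isDownset : ∀ x → IsDownset P (↓ P x)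
    ↓P-isDownset = ↓-isDownset P-trans
    images : Setoid.Carrier (𝓘 m k P) → Setoid.Carrier (𝓗 m k P)
    images (R , _ , R-covers) =
        image R
      , (λ Ds _ → image-⋃ R Ds)
      , (λ D _ RD≡∅ → Empty-unique λ (x , x∈D) → let (a , Rax) = R-covers x in
          ∉⊥ (subst (a ∈_) RD≡∅ (from ∈-image (x , x∈D , Rax))))
    fromImages : Setoid.Carrier (𝓗 m k P) → Setoid.Carrier (𝓘 m k P)
    fromImages (h , h-⋃ , h-reflects-∅) =
        (λ a x → lookup (h (↓ P x)) a)
      , (λ a x y a∈h↓x x≤y → to ∈⇔T-lookup (from (∈-h-downset P-pre h-⋃ (↓P-isDownset y))
          (x , from (∈-↓ P) x≤y , from ∈⇔T-lookup a∈h↓x)))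
      , covers
      where
      covers : ∀ y → ∃[ a ] T (lookup (h (↓ P y)) a)
      covers y with nonempty? (h (↓ P y))
      ... | yes (a , a∈) = a , to ∈⇔T-lookup a∈
      ... | no empty = ⊥-elim (∉⊥ (subst (y ∈_)
              (h-reflects-∅ (↓ P y) (↓P-isDownset y) (Empty-unique empty)) (from (∈-↓ P) P-refl)))

  glueSides : (Fin m → Fin k → Bool) → Fin m ⊎ Fin k → Fin m ⊎ Fin k → Bool
  glueSides R (inj₁ a) (inj₁ b) = ⌊ a ≟ b ⌋
  glueSides R (inj₁ a) (inj₂ y) = R a y
  glueSides R (inj₂ x) (inj₁ b) = false
  glueSides R (inj₂ x) (inj₂ y) = P x y

  glue : (Fin m → Fin k → Bool) → BRel (m + k)
  glue R z w = glueSides R (splitAt m z) (splitAt m w)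

  module _ (R : Fin m → Fin k → Bool) where

    glue-MM : ∀ a b → glue R (a ↑ˡ k) (b ↑ˡ k) ≡ ⌊ a ≟ b ⌋
    glue-MM a b rewrite splitAt-↑ˡ m a k | splitAt-↑ˡ m b k = refl

    glue-MK : ∀ a y → glue R (a ↑ˡ k) (m ↑ʳ y) ≡ R a y
    glue-MK a y rewrite splitAt-↑ˡ m a k | splitAt-↑ʳ m k y = refl

    glue-KM : ∀ x b → glue R (m ↑ʳ x) (b ↑ˡ k) ≡ false
    glue-KM x b rewrite splitAt-↑ʳ m k x | splitAt-↑ˡ m b k = refl

    glue-KK : ∀ x y → glue R (m ↑ʳ x) (m ↑ʳ y) ≡ P x y
    glue-KK x y rewrite splitAt-↑ʳ m k x | splitAt-↑ʳ m k y = refl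

  module _ {R : Fin m → Fin k → Bool} where

    ≤-MM : ∀ {a b} → T (glue R (a ↑ˡ k) (b ↑ˡ k)) → a ≡ b
    ≤-MM {a} {b} = toWitness ∘ subst T (glue-MM R a b)

    ≰-KM : ∀ {x b} → ¬ T (glue R (m ↑ʳ x) (b ↑ˡ k))
    ≰-KM {x} {b} = subst T (glue-KM R x b)

    ≤-MK : ∀ {a y} → T (glue R (a ↑ˡ k) (m ↑ʳ y)) ⇔ T (R a y)
    ≤-MK {a} {y} = mk⇔ (subst T (glue-MK R a y)) (subst T (sym (glue-MK R a y)))

    ≤-KK : ∀ {x y} → T (glue R (m ↑ʳ x) (m ↑ʳ y)) ⇔ T (P x y)
    ≤-KK {x} {y} = mk⇔ (subst T (glue-KK R x y)) (subst T (sym (glue-KK R x y)))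

  glue-isE : ∀ {R} → IsI m k P R → IsE m k P (glue R)
  glue-isE {R} (R-up , R-covers) =
    mkIsPoset ≤-refl ≤-trans ≤-antisym , (λ z → mk⇔ (minimal⇒InM z) InM⇒minimal) , λ _ _ → ≤-KK
    where
    ≤-refl : ∀ {z} → T (glue R z z)
    ≤-refl {z} with side m k z
    ... | inM a = subst T (sym (glue-MM R a a)) (fromWitness refl)
    ... | inK x = from ≤-KK P-refl
    ≤-trans : ∀ {z w v} → T (glue R z w) → T (glue R w v) → T (glue R z v)
    ≤-trans {z} {w} {v} z≤w w≤v with side m k z | side m k w | side m k v
    ... | inM a | inM b | inM c = subst T (sym (glue-MM R a c)) (fromWitness (trans (≤-MM z≤w) (≤-MM w≤v)))
    ... | inM a | inM b | inK y = subst (λ c → T (glue R (c ↑ˡ k) (m ↑ʳ y))) (sym (≤-MM z≤w)) w≤v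
    ... | inM a | inK x | inK y = from ≤-MK (R-up a x y (to ≤-MK z≤w) (to ≤-KK w≤v))
    ... | inK x | inK y | inK u = from ≤-KK (P-trans (to ≤-KK z≤w) (to ≤-KK w≤v))
    ... | _ | inK x | inM c = ⊥-elim (≰-KM w≤v)
    ... | inK x | inM b | _ = ⊥-elim (≰-KM z≤w)
    ≤-antisym : ∀ {z w} → T (glue R z w) → T (glue R w z) → z ≡ w
    ≤-antisym {z} {w} z≤w w≤z with side m k z | side m k w
    ... | inM a | inM b = cong (_↑ˡ k) (≤-MM z≤w)
    ... | inM a | inK y = ⊥-elim (≰-KM w≤z)
    ... | inK x | inM b = ⊥-elim (≰-KM z≤w)
    ... | inK x | inK y = cong (m ↑ʳ_) (P-antisym (to ≤-KK z≤w) (to ≤-KK w≤z))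
    minimal⇒InM : ∀ z → IsMinimal (glue R) z → InM m k z
    minimal⇒InM z z-min with side m k z
    ... | inM a = a , refl
    ... | inK x = let (a , Rax) = R-covers x in ⊥-elim (↑ˡ≢↑ʳ m k (z-min (a ↑ˡ k) (from ≤-MK Rax)))
    InM⇒minimal : ∀ {z} → InM m k z → IsMinimal (glue R) z
    InM⇒minimal (a , refl) w w≤a with side m k w
    ... | inM b = cong (_↑ˡ k) (≤-MM w≤a)
    ... | inK x = ⊥-elim (≰-KM w≤a)

  glueSides-cong : ∀ {R R′} → (∀ a x → R a x ≡ R′ a x) →
    ∀ s t → glueSides R s t ≡ glueSides R′ s t
  glueSides-cong R≗R′ (inj₁ a) (inj₁ b) = refl
  glueSides-cong R≗R′ (inj₁ a) (inj₂ y) = R≗R′ a y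
  glueSides-cong R≗R′ (inj₂ x) (inj₁ b) = refl
  glueSides-cong R≗R′ (inj₂ x) (inj₂ y) = refl

  restriction : BRel (m + k) → Fin m → Fin k → Bool
  restriction Q a x = Q (a ↑ˡ k) (m ↑ʳ x)

  module _ {Q : BRel (m + k)} (Q-isE : IsE m k P Q) where

    private
      Q-po : IsPoset Q
      Q-po = proj₁ Q-isE
      Q-min : ∀ z → IsMinimal Q z ⇔ InM m k z
      Q-min = proj₁ (proj₂ Q-isE)
      Q-induces : ∀ x y → T (Q (m ↑ʳ x) (m ↑ʳ y)) ⇔ T (P x y)
      Q-induces = proj₂ (proj₂ Q-isE)

    open IsPartialOrder Q-po using () renaming (refl to Q-refl; trans to Q-trans)

    M-minimal : ∀ a → IsMinimal Q (a ↑ˡ k)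
    M-minimal a = from (Q-min (a ↑ˡ k)) (a , refl)

    restriction-isI : IsI m k P (restriction Q)
    restriction-isI =
        (λ a x y a≤x x≤y → Q-trans a≤x (from (Q-induces x y) x≤y))
      , λ y → let (w , w≤y , w-min) = minimal-below Q-po (m ↑ʳ y)
                  (a , w≡a) = to (Q-min w) w-min
              in a , subst (λ u → T (Q u (m ↑ʳ y))) w≡a w≤y

    glue-restriction : ∀ z w → glue (restriction Q) z w ≡ Q z w
    glue-restriction z w with side m k z | side m k w
    ... | inM a | inM b = trans (glue-MM _ a b) (T-ext
          (λ a≡b → subst (λ c → T (Q (a ↑ˡ k) (c ↑ˡ k))) (toWitness a≡b) Q-refl)
          (λ a≤b → fromWitness (↑ˡ-injective k a b (M-minimal b (a ↑ˡ k) a≤b))))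
    ... | inM a | inK y = glue-MK _ a y
    ... | inK x | inM b = trans (glue-KM _ x b) (T-ext (λ ())
          (λ x≤b → ↑ˡ≢↑ʳ m k (sym (M-minimal b (m ↑ʳ x) x≤b))))
    ... | inK x | inK y = trans (glue-KK _ x y) (T-ext (from (Q-induces x y)) (to (Q-induces x y)))

  𝓔↔𝓘 : Inverse (𝓔 m k P) (𝓘 m k P)
  𝓔↔𝓘 = mkInverse {S = 𝓔 m k P} {R = 𝓘 m k P}
    (λ (Q , Q-isE) → restriction Q , restriction-isI Q-isE)
    (λ (R , R-isI) → glue R , glue-isE R-isI)
    (λ Q≈Q′ (a , x) _ → Q≈Q′ (a ↑ˡ k , m ↑ʳ x) Fin.zero)
    (λ R≈R′ (z , w) _ → glueSides-cong (λ a x → R≈R′ (a , x) Fin.zero) (splitAt m z) (splitAt m w))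
    (λ (R , _) (a , x) _ → glue-MK R a x)
    (λ (Q , Q-isE) (z , w) _ → glue-restriction Q-isE z w)

  downsets-isTopE : ∀ {Q} → IsE m k P Q → IsTopE m k P (downsets Q)
  downsets-isTopE {Q} (Q-po , Q-min , Q-induces) =
      downsets-isTopology Q , downsets-isT0 Q-po , subspace
    , λ z → Q-min z ⇔-∘ (⁅⁆-isDownset⇔isMinimal ⇔-∘ T-downsets)
    where
    subspace : ∀ S → (∃[ U ] T (downsets Q U) × drop m U ≡ S) ⇔ IsDownset P S
    subspace S = mk⇔
      (λ { (U , U-open , U∩K≡S) x y y≤x x∈S → subst (y ∈_) U∩K≡S (from (∈-drop m)
            (to T-downsets U-open (m ↑ʳ x) (m ↑ʳ y) (from (Q-induces y x) y≤x)
              (to (∈-drop m) (subst (x ∈_) (sym U∩K≡S) x∈S)))) })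
      (λ S-down → Full ++ S , from T-downsets (M∪S-isDownset S-down) , drop-++ m Full S)
      where
      M∪S-isDownset : IsDownset P S → IsDownset Q (Full ++ S)
      M∪S-isDownset S-down z w w≤z z∈ with side m k w | side m k z
      ... | inM a | _ = ↑ˡ-∈-Full++ S a
      ... | inK y | inM b = ⊥-elim (↑ˡ≢↑ʳ m k (sym (from (Q-min (b ↑ˡ k)) (b , refl) (m ↑ʳ y) w≤z)))
      ... | inK y | inK x = to (∈-drop m) (subst (y ∈_) (sym (drop-++ m Full S))
            (S-down x y (to (Q-induces y x) w≤z) (subst (x ∈_) (drop-++ m Full S) (from (∈-drop m) z∈))))

  specialisation-isE : ∀ {τ} → IsTopE m k P τ → IsE m k P (specialisation τ)
  specialisation-isE {τ} (τ-top , τ-T0 , τ-subspace , τ-isolated) =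
    specialisation-isPoset τ-T0 , minimal⇔M , induces
    where
    minimal⇔M : ∀ z → IsMinimal (specialisation τ) z ⇔ InM m k z
    minimal⇔M z = mk⇔
      (λ z-min → to (τ-isolated z) (subst T (downsets-specialisation τ-top ⁅ z ⁆)
        (from T-downsets (from ⁅⁆-isDownset⇔isMinimal z-min))))
      (λ z∈M → to ⁅⁆-isDownset⇔isMinimal (to T-downsets
        (subst T (sym (downsets-specialisation τ-top ⁅ z ⁆)) (from (τ-isolated z) z∈M))))
    induces : ∀ x y → T (specialisation τ (m ↑ʳ x) (m ↑ʳ y)) ⇔ T (P x y)
    induces x y = mk⇔
      (λ x≤y → let (U , U-open , U∩K≡↓y) = from (τ-subspace (↓ P y)) (↓-isDownset P-trans y)
                   y∈U = to (∈-drop m) (subst (y ∈_) (sym U∩K≡↓y) (from (∈-↓ P) P-refl))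
               in to (∈-↓ P) (subst (x ∈_) U∩K≡↓y
                    (from (∈-drop m) (to T-specialisation x≤y U U-open y∈U))))
      (λ x≤y → from T-specialisation λ U U-open y∈U → to (∈-drop m)
        (to (τ-subspace (drop m U)) (U , U-open , refl) y x x≤y (from (∈-drop m) y∈U)))

  𝓔↔𝓣 : Inverse (𝓔 m k P) (𝓣 m k P)
  𝓔↔𝓣 = mkInverse {S = 𝓔 m k P} {R = 𝓣 m k P}
    (λ (Q , Q-isE) → downsets Q , downsets-isTopE Q-isE)
    (λ (τ , τ-isTopE) → specialisation τ , specialisation-isE τ-isTopE)
    (λ Q≈Q′ U _ → downsets-cong (λ x y → Q≈Q′ (x , y) Fin.zero) U)
    (λ τ≈τ′ (x , y) _ → specialisation-cong (λ U → τ≈τ′ U Fin.zero) x y)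
    (λ (τ , τ-top , _) U _ → downsets-specialisation τ-top U)
    (λ (Q , Q-po , _) (x , y) _ → specialisation-downsets (IsPartialOrder.isPreorder Q-po) x y)

theorem4p1 : (m k : ℕ) (P : BRel k) → IsPoset P →
    Inverse (𝓔 m k P) (𝓕 m k P) × Inverse (𝓔 m k P) (𝓖 m k P)
    × Inverse (𝓔 m k P) (𝓗 m k P) × Inverse (𝓔 m k P) (𝓘 m k P)
    × Inverse (𝓔 m k P) (𝓣 m k P)
theorem4p1 m k P P-po =
  𝓔↔𝓘 ⨾ 𝓘↔𝓕 , 𝓔↔𝓘 ⨾ 𝓘↔𝓖 , 𝓔↔𝓘 ⨾ 𝓘↔𝓗 , 𝓔↔𝓘 , 𝓔↔𝓣
  where open Correspondences m k P P-po
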